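{- There is an absolute constant $c>0$ such that for all sufficiently large $n$, every integer $p$ with $1\le p\le\log n$, and every increment sequence $h_1,\ldots,h_p$ of positive integers with $h_p=1$, the expected total number of comparisons made by $p$-pass Shellsort with increments $h_1,\ldots,h_p$ on a uniformly random permutation of $\{1,\ldots,n\}$ is at least $c\,p\,n^{1+1/p}$; that is, it is $\Omega(p n^{1+1/p})$.
   Context: $\log$ denotes the binary logarithm. $p$-pass Shellsort with increments $h_1,\ldots,h_p$ (positive integers, $h_p=1$) sorts a list $a_1,\ldots,a_n$ into increasing order in $p$ passes. In pass $k$, for each $r\in\{1,\ldots,h_k\}$ the sublist (the "$h_k$-chain") of entries at positions $j\equiv r\pmod{h_k}$ is sorted in place by straight insertion sort. For an element $i$ and pass $k$, let $m_{i,k}$ be the number of elements in the $h_k$-chain containing $i$ that lie to the left of $i$ and are larger than $i$ at the beginning of pass $k$. The number of comparisons made in pass $k$ is $\sum_{i=1}^n (m_{i,k}+1)$, and the total number of comparisons is $\sum_{k=1}^p\sum_{i=1}^n (m_{i,k}+1)$. The constant $c$ does not depend on $n$, $p$ or the increments. -}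

module Defs where

open import Data.Nat using (ℕ; zero; suc; _+_; _*_; _<ᵇ_; _≡ᵇ_)
open import Data.Nat.DivMod using (_%_; _/_)
open import Data.Bool using (Bool; true; false; if_then_else_; _∧_)
open import Data.List using (List; []; _∷_; map; upTo; length; concatMap; filter)
open import Data.Nat.ListAction using (sum)

-- Lists are 0-indexed here; chain classes j ≡ r (mod h) for 0-based positions
-- are the same sets as for 1-based positions, so this is only a relabelling.

-- lookup with default 0 (only used at valid indices)
at : List ℕ → ℕ → ℕ
at []       _       = 0
at (x ∷ xs) zero    = x
at (x ∷ xs) (suc i) = at xs i

insertions : ℕ → List ℕ → List (List ℕ)
insertions x []       = (x ∷ []) ∷ []
insertions x (y ∷ ys) = (x ∷ y ∷ ys) ∷ map (y ∷_) (insertions x ys)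

permutations : List ℕ → List (List ℕ)
permutations []       = [] ∷ []
permutations (x ∷ xs) = concatMap (insertions x) (permutations xs)

permsOf : ℕ → List (List ℕ)
permsOf n = permutations (map suc (upTo n))

ins : ℕ → List ℕ → List ℕ
ins x []       = x ∷ []
ins x (y ∷ ys) = if y <ᵇ x then y ∷ ins x ys else x ∷ y ∷ ys

isort : List ℕ → List ℕ
isort []       = []
isort (x ∷ xs) = ins x (isort xs)

sameClass : ℕ → ℕ → ℕ → Bool
sameClass zero     i j = true
sameClass (suc h') i j = (i % suc h') ≡ᵇ (j % suc h')

chainOf : ℕ → List ℕ → ℕ → List ℕ
chainOf h xs j = map (at xs) (filter (λ i → sameClass h i j Data.Bool.≟ true) (upTo (length xs)))
  where import Data.Bool

posInChain : ℕ → ℕ → ℕ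
posInChain zero     j = j
posInChain (suc h') j = j / suc h'

hsort : ℕ → List ℕ → List ℕ
hsort h xs = map (λ j → at (isort (chainOf h xs j)) (posInChain h j)) (upTo (length xs))

leftLarger : ℕ → List ℕ → ℕ → ℕ
leftLarger h xs j =
  length (filter (λ i → (sameClass h i j ∧ (at xs j <ᵇ at xs i)) Data.Bool.≟ true) (upTo j))
  where import Data.Bool

-- comparisons of one pass: Σ_i (m_{i,k} + 1)
passCost : ℕ → List ℕ → ℕ
passCost h xs = sum (map (λ j → leftLarger h xs j + 1) (upTo (length xs)))

shellCost : List ℕ → List ℕ → ℕ
shellCost []       xs = 0
shellCost (h ∷ hs) xs = passCost h xs + shellCost hs (hsort h xs)

totalOverPerms : ℕ → List ℕ → ℕ
totalOverPerms n hs = sum (map (shellCost hs) (permsOf n))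

-- A run of Shellsort is recorded by its inversion tables: for every pass k and position i the
-- number m_{i,k}.  These tables determine the input permutation.  The last pass (h = 1) always
-- outputs the sorted list, and an h-pass can be undone from its output and its table: it keeps
-- the multiset of every h-chain, and an entry is pinned down, from right to left, by how many
-- members of its chain exceed it overall and to its left.  The cost of a run is p·n plus the sum
-- of its table, a list of p·n naturals.  Choose r with (96r)^p ≤ n < (96(r+1))^p.  At most
-- C(rpn + pn, pn) ≤ (6r)^(pn) ≤ n!/2 tables have sum below r·p·n, so at least half of the n!
-- inputs cost (r+1)·p·n or more, and the total cost is at least n^(1/p)·p·n·n!/192.

module Submission where

open import Defs
open import Data.Nat using (ℕ; _+_; _*_; _^_; _≤_)
open import Data.Nat using (_!)
open import Data.Nat.Logarithm using (⌊log₂_⌋)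
open import Data.List using (List; length; last)
open import Data.List.Relation.Unary.All using (All)
open import Data.Maybe using (just)
open import Data.Product using (∃-syntax; _×_)
open import Relation.Binary.PropositionalEquality using (_≡_)
open import Data.Bool using (Bool; true; false; _∧_; if_then_else_; T)
open import Data.Bool.Properties using (_≟_; T-≡)
open import Data.Empty using (⊥; ⊥-elim)
open import Data.List using ([]; _∷_; _++_; _∷ʳ_; map; upTo; applyUpTo; filter; concatMap)
open import Data.List.Properties
  using (upTo-∷ʳ; length-++; filter-++; map-++; map-∘; map-upTo; length-map; length-upTo; map-cong-local;
         ++-identityʳ; ∷-injective; ∷-injectiveˡ; ∷-injectiveʳ; filter-all; length-filter)
open import Data.List.Membership.Propositional using (_∈_)
open import Data.List.Relation.Unary.All as All using ([]; _∷_)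
import Data.List.Relation.Unary.All.Properties as All
open import Data.List.Relation.Unary.Any using (here; there)
open import Data.List.Relation.Unary.AllPairs using (AllPairs; []; _∷_)
open import Data.List.Relation.Unary.Unique.Propositional using (Unique)
import Data.List.Relation.Unary.Unique.Propositional.Properties as Unique
open import Data.List.Relation.Binary.Permutation.Propositional using (_↭_; ↭-refl; ↭-prep; ↭-swap; ↭-trans; ↭-sym)
open import Data.List.Relation.Binary.Permutation.Propositional.Properties using (All-resp-↭; ↭-length; filter-↭)
open import Data.Maybe.Properties using (just-injective)
open import Data.Nat hiding (_≟_)
open import Data.Nat.Properties hiding (_≟_)
open import Data.Nat.DivMod
open import Data.Nat.Divisibility using (divides)
open import Data.Nat.ListAction using (sum)
open import Data.Nat.ListAction.Properties using (sum-++)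
open import Data.Nat.Solver using (module +-*-Solver)
open import Data.Product using (∃; _,_; proj₁; proj₂)
open import Function using (_∘_; _∘′_; Equivalence)
open import Relation.Binary.Definitions using (tri<; tri≈; tri>)
open import Relation.Binary.PropositionalEquality
open import Relation.Nullary using (yes; no)
import Algebra.Properties.CommutativeSemigroup +-commutativeSemigroup as +-CS
import Algebra.Properties.CommutativeSemigroup *-commutativeSemigroup as *-CS
open +-*-Solver using (solve; _:*_; _:+_; _:=_; con)

bit : Bool → ℕ
bit true  = 1
bit false = 0

bit-mono : ∀ {a b} → (a ≡ true → b ≡ true) → bit a ≤ bit b
bit-mono {true}  a⇒b rewrite a⇒b refl = ≤-refl
bit-mono {false} _   = z≤n

<⇒<ᵇ≡true : ∀ {m n} → m < n → (m <ᵇ n) ≡ true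
<⇒<ᵇ≡true = Equivalence.to T-≡ ∘ <⇒<ᵇ

<ᵇ≡true⇒< : ∀ m n → (m <ᵇ n) ≡ true → m < n
<ᵇ≡true⇒< m n = <ᵇ⇒< m n ∘ Equivalence.from T-≡

<ᵇ≡false⇒≥ : ∀ m n → (m <ᵇ n) ≡ false → n ≤ m
<ᵇ≡false⇒≥ m n m<ᵇn≡false = ≮⇒≥ (λ m<n → subst T m<ᵇn≡false (<⇒<ᵇ m<n))

n<ᵇn≡false : ∀ n → (n <ᵇ n) ≡ false
n<ᵇn≡false zero    = refl
n<ᵇn≡false (suc n) = n<ᵇn≡false n

≡ᵇ-refl : ∀ n → (n ≡ᵇ n) ≡ true
≡ᵇ-refl zero    = refl
≡ᵇ-refl (suc n) = ≡ᵇ-refl n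

≢⇒≡ᵇ≡false : ∀ m n → m ≢ n → (m ≡ᵇ n) ≡ false
≢⇒≡ᵇ≡false m n m≢n with m ≡ᵇ n in eq
... | false = refl
... | true  = ⊥-elim (m≢n (≡ᵇ⇒≡ m n (Equivalence.from T-≡ eq)))

∧-monoʳ-≡true : ∀ a {b c} → (b ≡ true → c ≡ true) → a ∧ b ≡ true → a ∧ c ≡ true
∧-monoʳ-≡true true b⇒c = b⇒c

-- The boolean filter in exactly the form used by `chainOf` and `leftLarger`, so that they unfold to it.
select : {A : Set} → (A → Bool) → List A → List A
select P = filter (λ x → P x ≟ true)

length-select-∷ : {A : Set} (P : A → Bool) (x : A) (xs : List A) →
  length (select P (x ∷ xs)) ≡ bit (P x) + length (select P xs)
length-select-∷ P x xs with P x
... | true  = refl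
... | false = refl

length-select-++ : {A : Set} (P : A → Bool) (xs ys : List A) →
  length (select P (xs ++ ys)) ≡ length (select P xs) + length (select P ys)
length-select-++ P xs ys =
  trans (cong length (filter-++ (λ x → P x ≟ true) xs ys)) (length-++ (select P xs))

All-select : {A : Set} {Q : A → Set} (P : A → Bool) {xs : List A} →
  All Q xs → All (λ x → Q x × P x ≡ true) (select P xs)
All-select P {xs} qs = All.zip (All.filter⁺ (λ x → P x ≟ true) qs , All.all-filter (λ x → P x ≟ true) xs)

select-map : {A B : Set} (U : B → Bool) (f : A → B) (xs : List A) →
  select U (map f xs) ≡ map f (select (U ∘ f) xs)
select-map U f []       = refl
select-map U f (x ∷ xs) with U (f x)
... | true  = cong (f x ∷_) (select-map U f xs)
... | false = select-map U f xs

select-select : {A : Set} (S V : A → Bool) (xs : List A) →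
  select V (select S xs) ≡ select (λ x → S x ∧ V x) xs
select-select S V []       = refl
select-select S V (x ∷ xs) with S x
... | false = select-select S V xs
... | true with V x
...   | true  = cong (x ∷_) (select-select S V xs)
...   | false = select-select S V xs

countBelow : (ℕ → Bool) → ℕ → ℕ
countBelow P zero    = 0
countBelow P (suc n) = countBelow P n + bit (P n)

length-select-upTo : ∀ P n → length (select P (upTo n)) ≡ countBelow P n
length-select-upTo P zero    = refl
length-select-upTo P (suc n) = begin
  length (select P (upTo (suc n)))                           ≡⟨ cong (length ∘ select P) (upTo-∷ʳ n) ⟨
  length (select P (upTo n ++ n ∷ []))                       ≡⟨ length-select-++ P (upTo n) (n ∷ []) ⟩
  length (select P (upTo n)) + length (select P (n ∷ []))
    ≡⟨ cong₂ _+_ (length-select-upTo P n) (length-select-∷ P n []) ⟩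
  countBelow P n + (bit (P n) + 0)                           ≡⟨ cong (countBelow P n +_) (+-identityʳ _) ⟩
  countBelow P n + bit (P n)                                 ∎
  where open ≡-Reasoning

countBelow-cong : ∀ P Q n → (∀ i → i < n → P i ≡ Q i) → countBelow P n ≡ countBelow Q n
countBelow-cong P Q zero    _  = refl
countBelow-cong P Q (suc n) eq =
  cong₂ _+_ (countBelow-cong P Q n (λ i i<n → eq i (m<n⇒m<1+n i<n))) (cong bit (eq n ≤-refl))

countBelow-mono : ∀ P Q n → (∀ i → i < n → P i ≡ true → Q i ≡ true) → countBelow P n ≤ countBelow Q n
countBelow-mono P Q zero    _   = z≤n
countBelow-mono P Q (suc n) P⇒Q =
  +-mono-≤ (countBelow-mono P Q n (λ i i<n → P⇒Q i (m<n⇒m<1+n i<n))) (bit-mono (P⇒Q n ≤-refl))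

countBelow-+ : ∀ P m n → countBelow P (m + n) ≡ countBelow P m + countBelow (λ i → P (m + i)) n
countBelow-+ P m zero    rewrite +-identityʳ m = sym (+-identityʳ _)
countBelow-+ P m (suc n) rewrite +-suc m n | countBelow-+ P m n = +-assoc (countBelow P m) _ _

sumBelow : ℕ → (ℕ → ℕ) → ℕ
sumBelow zero    f = 0
sumBelow (suc m) f = sumBelow m f + f m

sumBelow-zero : ∀ m → sumBelow m (λ _ → 0) ≡ 0
sumBelow-zero zero    = refl
sumBelow-zero (suc m) = trans (+-identityʳ _) (sumBelow-zero m)

sumBelow-+ : ∀ m f g → sumBelow m (λ r → f r + g r) ≡ sumBelow m f + sumBelow m g
sumBelow-+ zero    f g = refl
sumBelow-+ (suc m) f g = trans (cong (_+ (f m + g m)) (sumBelow-+ m f g)) (+-CS.interchange (sumBelow m f) (sumBelow m g) (f m) (g m))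

sumBelow-cong : ∀ m f g → (∀ r → r < m → f r ≡ g r) → sumBelow m f ≡ sumBelow m g
sumBelow-cong zero    f g _  = refl
sumBelow-cong (suc m) f g eq = cong₂ _+_ (sumBelow-cong m f g (λ r r<m → eq r (m<n⇒m<1+n r<m))) (eq m ≤-refl)

hasResidue : ℕ → ℕ → ℕ → Bool
hasResidue h′ r i = i % suc h′ ≡ᵇ r

divMod-unique : ∀ h′ s q → s < suc h′ → (s + q * suc h′) % suc h′ ≡ s × (s + q * suc h′) / suc h′ ≡ q
divMod-unique h′ s q s<h =
  trans ([m+kn]%n≡m%n s q (suc h′)) (m<n⇒m%n≡m s<h) ,
  trans (+-distrib-/-∣ʳ s (divides q refl)) (cong₂ _+_ (m<n⇒m/n≡0 s<h) (m*n/n≡m q (suc h′)))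

bit-<ᵇ-suc : ∀ r m → bit (r <ᵇ m) + bit (m ≡ᵇ r) ≡ bit (r <ᵇ suc m)
bit-<ᵇ-suc zero    zero    = refl
bit-<ᵇ-suc zero    (suc m) = refl
bit-<ᵇ-suc (suc r) zero    = refl
bit-<ᵇ-suc (suc r) (suc m) = bit-<ᵇ-suc r m

-- Passing from L to suc L either increments the remainder or wraps it to 0 and increments the quotient.
divMod-suc : ∀ h′ r L → r < suc h′ →
  L / suc h′ + bit (r <ᵇ suc (L % suc h′)) ≡ suc L / suc h′ + bit (r <ᵇ suc L % suc h′)
divMod-suc h′ r L r<h with <-cmp (suc (L % suc h′)) (suc h′)
... | tri< m+1<h _ _ = cong₂ (λ q s → q + bit (r <ᵇ s)) (sym (proj₂ du)) (sym (proj₁ du))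
  where
  h = suc h′
  du : suc L % h ≡ suc (L % h) × suc L / h ≡ L / h
  du = subst (λ n → n % h ≡ suc (L % h) × n / h ≡ L / h)
         (cong suc (sym (m≡m%n+[m/n]*n L h))) (divMod-unique h′ (suc (L % h)) (L / h) m+1<h)
... | tri≈ _ m+1≡h _ = begin
  L / h + bit (r <ᵇ suc (L % h))  ≡⟨ cong (λ s → L / h + bit (r <ᵇ s)) m+1≡h ⟩
  L / h + bit (r <ᵇ h)            ≡⟨ cong (λ b → L / h + bit b) (<⇒<ᵇ≡true r<h) ⟩
  L / h + 1                       ≡⟨ trans (+-comm (L / h) 1) (sym (+-identityʳ _)) ⟩
  suc (L / h) + 0                 ≡⟨ cong₂ (λ q s → q + bit (r <ᵇ s)) (sym (proj₂ du)) (sym (proj₁ du)) ⟩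
  suc L / h + bit (r <ᵇ suc L % h) ∎
  where
  open ≡-Reasoning
  h = suc h′
  du : suc L % h ≡ 0 × suc L / h ≡ suc (L / h)
  du = subst (λ n → n % h ≡ 0 × n / h ≡ suc (L / h))
         (sym (trans (cong suc (m≡m%n+[m/n]*n L h)) (cong (_+ L / h * h) m+1≡h)))
         (divMod-unique h′ 0 (suc (L / h)) z<s)
... | tri> _ _ m+1>h = ⊥-elim (<-irrefl refl (<-≤-trans m+1>h (m%n<n L (suc h′))))

countBelow-hasResidue : ∀ h′ r → r < suc h′ → ∀ L →
  countBelow (hasResidue h′ r) L ≡ L / suc h′ + bit (r <ᵇ L % suc h′)
countBelow-hasResidue h′ r r<h zero    = refl
countBelow-hasResidue h′ r r<h (suc L) = begin
  countBelow (hasResidue h′ r) L + bit (L % h ≡ᵇ r)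
    ≡⟨ cong (_+ bit (L % h ≡ᵇ r)) (countBelow-hasResidue h′ r r<h L) ⟩
  L / h + bit (r <ᵇ L % h) + bit (L % h ≡ᵇ r)  ≡⟨ +-assoc (L / h) _ _ ⟩
  L / h + (bit (r <ᵇ L % h) + bit (L % h ≡ᵇ r)) ≡⟨ cong (L / h +_) (bit-<ᵇ-suc r (L % h)) ⟩
  L / h + bit (r <ᵇ suc (L % h))               ≡⟨ divMod-suc h′ r L r<h ⟩
  suc L / h + bit (r <ᵇ suc L % h)             ∎
  where
  open ≡-Reasoning
  h = suc h′

quotient≡countBelow : ∀ h′ L → L / suc h′ ≡ countBelow (hasResidue h′ (L % suc h′)) L
quotient≡countBelow h′ L = sym (begin
  countBelow (hasResidue h′ r) L ≡⟨ countBelow-hasResidue h′ r (m%n<n L (suc h′)) L ⟩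
  L / suc h′ + bit (r <ᵇ r)      ≡⟨ cong (λ b → L / suc h′ + bit b) (n<ᵇn≡false r) ⟩
  L / suc h′ + 0                 ≡⟨ +-identityʳ _ ⟩
  L / suc h′                     ∎)
  where
  open ≡-Reasoning
  r = L % suc h′

quotients-of-residueClass : ∀ h′ r L →
  map (_/ suc h′) (select (hasResidue h′ r) (upTo L)) ≡ upTo (countBelow (hasResidue h′ r) L)
quotients-of-residueClass h′ r zero    = refl
quotients-of-residueClass h′ r (suc L) = begin
  map (_/ h) (select P (upTo (suc L)))                           ≡⟨ cong (map (_/ h) ∘ select P) (upTo-∷ʳ L) ⟨
  map (_/ h) (select P (upTo L ++ L ∷ []))                       ≡⟨ cong (map (_/ h)) (filter-++ _ (upTo L) (L ∷ [])) ⟩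
  map (_/ h) (select P (upTo L) ++ select P (L ∷ []))            ≡⟨ map-++ (_/ h) (select P (upTo L)) _ ⟩
  map (_/ h) (select P (upTo L)) ++ map (_/ h) (select P (L ∷ []))
    ≡⟨ cong (_++ map (_/ h) (select P (L ∷ []))) (quotients-of-residueClass h′ r L) ⟩
  upTo (countBelow P L) ++ map (_/ h) (select P (L ∷ []))        ≡⟨ last-quotient ⟩
  upTo (countBelow P L + bit (P L))                              ∎
  where
  open ≡-Reasoning
  h = suc h′
  P = hasResidue h′ r
  last-quotient : upTo (countBelow P L) ++ map (_/ h) (select P (L ∷ [])) ≡ upTo (countBelow P L + bit (P L))
  last-quotient with P L in eq
  ... | false = trans (++-identityʳ _) (cong upTo (sym (+-identityʳ _)))
  ... | true  = begin
    upTo (countBelow P L) ∷ʳ L / h     ≡⟨ cong (λ q → upTo (countBelow P L) ∷ʳ q) L/h≡ ⟩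
    upTo (countBelow P L) ∷ʳ countBelow P L ≡⟨ upTo-∷ʳ _ ⟩
    upTo (suc (countBelow P L))        ≡⟨ cong upTo (+-comm 1 _) ⟩
    upTo (countBelow P L + 1)          ∎
    where
    L%h≡r : L % h ≡ r
    L%h≡r = ≡ᵇ⇒≡ _ _ (Equivalence.from T-≡ eq)
    L/h≡ : L / h ≡ countBelow P L
    L/h≡ = trans (quotient≡countBelow h′ L) (cong (λ s → countBelow (hasResidue h′ s) L) L%h≡r)

bit-<ᵇ-≡ᵇ : ∀ k m b → bit ((k <ᵇ m) ∧ b) + bit ((k ≡ᵇ m) ∧ b) ≡ bit ((k <ᵇ suc m) ∧ b)
bit-<ᵇ-≡ᵇ zero    zero    b     = +-identityˡ _
bit-<ᵇ-≡ᵇ zero    (suc m) true  = refl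
bit-<ᵇ-≡ᵇ zero    (suc m) false = refl
bit-<ᵇ-≡ᵇ (suc k) zero    b     = refl
bit-<ᵇ-≡ᵇ (suc k) (suc m) b     = bit-<ᵇ-≡ᵇ k m b

sumBelow-indicator : ∀ k b m → sumBelow m (λ r → bit ((k ≡ᵇ r) ∧ b)) ≡ bit ((k <ᵇ m) ∧ b)
sumBelow-indicator k b zero    = refl
sumBelow-indicator k b (suc m) =
  trans (cong (_+ bit ((k ≡ᵇ m) ∧ b)) (sumBelow-indicator k b m)) (bit-<ᵇ-≡ᵇ k m b)

countBelow-by-residue : ∀ h′ U L →
  sumBelow (suc h′) (λ r → countBelow (λ i → hasResidue h′ r i ∧ U i) L) ≡ countBelow U L
countBelow-by-residue h′ U zero    = sumBelow-zero (suc h′)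
countBelow-by-residue h′ U (suc L) = begin
  sumBelow h (λ r → countBelow (C r) L + bit (C r L))
    ≡⟨ sumBelow-+ h (λ r → countBelow (C r) L) (λ r → bit (C r L)) ⟩
  sumBelow h (λ r → countBelow (C r) L) + sumBelow h (λ r → bit (C r L))
    ≡⟨ cong₂ _+_ (countBelow-by-residue h′ U L) (sumBelow-indicator (L % h) (U L) h) ⟩
  countBelow U L + bit ((L % h <ᵇ h) ∧ U L)
    ≡⟨ cong (λ b → countBelow U L + bit (b ∧ U L)) (<⇒<ᵇ≡true (m%n<n L h)) ⟩
  countBelow U L + bit (U L) ∎
  where
  open ≡-Reasoning
  h = suc h′
  C : ℕ → ℕ → Bool
  C r i = hasResidue h′ r i ∧ U i

at-applyUpTo : ∀ (f : ℕ → ℕ) n i → i < n → at (applyUpTo f n) i ≡ f i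
at-applyUpTo f (suc n) zero    _         = refl
at-applyUpTo f (suc n) (suc i) (s≤s i<n) = at-applyUpTo (f ∘ suc) n i i<n

at-map-upTo : ∀ (f : ℕ → ℕ) n i → i < n → at (map f (upTo n)) i ≡ f i
at-map-upTo f n i i<n = trans (cong (λ xs → at xs i) (map-upTo f n)) (at-applyUpTo f n i i<n)

applyUpTo-at : ∀ xs → applyUpTo (at xs) (length xs) ≡ xs
applyUpTo-at []       = refl
applyUpTo-at (x ∷ xs) = cong (x ∷_) (applyUpTo-at xs)

map-at-upTo : ∀ xs → map (at xs) (upTo (length xs)) ≡ xs
map-at-upTo xs = trans (map-upTo (at xs) (length xs)) (applyUpTo-at xs)

≡-from-at : ∀ xs ys → length xs ≡ length ys → (∀ j → j < length xs → at xs j ≡ at ys j) → xs ≡ ys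
≡-from-at []       []       _   _     = refl
≡-from-at (x ∷ xs) (y ∷ ys) len same-at =
  cong₂ _∷_ (same-at 0 z<s) (≡-from-at xs ys (suc-injective len) (λ j j<n → same-at (suc j) (s<s j<n)))

length-ins : ∀ x xs → length (ins x xs) ≡ suc (length xs)
length-ins x []       = refl
length-ins x (y ∷ xs) with y <ᵇ x
... | true  = cong suc (length-ins x xs)
... | false = refl

length-isort : ∀ xs → length (isort xs) ≡ length xs
length-isort []       = refl
length-isort (x ∷ xs) = trans (length-ins x (isort xs)) (cong suc (length-isort xs))

length-map-upTo : ∀ (f : ℕ → ℕ) n → length (map f (upTo n)) ≡ n
length-map-upTo f n = trans (length-map f (upTo n)) (length-upTo n)

length-hsort : ∀ h xs → length (hsort h xs) ≡ length xs
length-hsort h xs = length-map-upTo _ (length xs)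

length-hsort-cong : ∀ h xs ys → length xs ≡ length ys → length (hsort h xs) ≡ length (hsort h ys)
length-hsort-cong h xs ys len = trans (length-hsort h xs) (trans len (sym (length-hsort h ys)))

at-hsort : ∀ h xs i → i < length xs → at (hsort h xs) i ≡ at (isort (chainOf h xs i)) (posInChain h i)
at-hsort h xs = at-map-upTo (λ j → at (isort (chainOf h xs j)) (posInChain h j)) (length xs)

chainOf-hsort : ∀ h′ xs j → chainOf (suc h′) (hsort (suc h′) xs) j ≡ isort (chainOf (suc h′) xs j)
chainOf-hsort h′ xs j = begin
  map (at (hsort h xs)) (select P (upTo (length (hsort h xs))))
    ≡⟨ cong (λ n → map (at (hsort h xs)) (select P (upTo n))) (length-hsort h xs) ⟩
  map (at (hsort h xs)) (select P (upTo L))   ≡⟨ map-cong-local (All.map at-class (All-select P (All.all-upTo L))) ⟩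
  map (at c ∘ (_/ h)) (select P (upTo L))     ≡⟨ map-∘ (select P (upTo L)) ⟩
  map (at c) (map (_/ h) (select P (upTo L))) ≡⟨ cong (map (at c)) (quotients-of-residueClass h′ r L) ⟩
  map (at c) (upTo (countBelow P L))          ≡⟨ cong (map (at c) ∘ upTo) length-c ⟨
  map (at c) (upTo (length c))                ≡⟨ map-at-upTo c ⟩
  c                                           ∎
  where
  open ≡-Reasoning
  h = suc h′
  r = j % h
  P = hasResidue h′ r
  L = length xs
  c = isort (chainOf h xs j)
  at-class : ∀ {i} → i < L × P i ≡ true → at (hsort h xs) i ≡ at c (i / h)
  at-class {i} (i<L , i∈P) = trans (at-hsort h xs i i<L)
    (cong (λ s → at (isort (map (at xs) (select (hasResidue h′ s) (upTo L)))) (i / h))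
          (≡ᵇ⇒≡ _ _ (Equivalence.from T-≡ i∈P)))
  length-c : length c ≡ countBelow P L
  length-c = trans (length-isort (chainOf h xs j))
    (trans (length-map (at xs) (select P (upTo L))) (length-select-upTo P L))

hsort-1 : ∀ xs → hsort 1 xs ≡ isort xs
hsort-1 xs = trans (sym (chainOf-1 (hsort 1 xs))) (trans (chainOf-hsort 0 xs 0) (cong isort (chainOf-1 xs)))
  where
  chainOf-1 : ∀ ys → chainOf 1 ys 0 ≡ ys
  chainOf-1 ys = trans (cong (map (at ys)) (filter-all _ (All.universal (λ i → cong (_≡ᵇ 0) (n%1≡0 i)) _)))
                       (map-at-upTo ys)

countAbove : ℕ → List ℕ → ℕ
countAbove u xs = length (select (u <ᵇ_) xs)

countAbove-ins : ∀ u x xs → countAbove u (ins x xs) ≡ countAbove u (x ∷ xs)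
countAbove-ins u x []       = refl
countAbove-ins u x (y ∷ xs) with y <ᵇ x
... | false = refl
... | true  = begin
  countAbove u (y ∷ ins x xs)         ≡⟨ length-select-∷ (u <ᵇ_) y (ins x xs) ⟩
  bit (u <ᵇ y) + countAbove u (ins x xs)
    ≡⟨ cong (bit (u <ᵇ y) +_) (trans (countAbove-ins u x xs) (length-select-∷ (u <ᵇ_) x xs)) ⟩
  bit (u <ᵇ y) + (bit (u <ᵇ x) + countAbove u xs) ≡⟨ +-CS.x∙yz≈y∙xz (bit (u <ᵇ y)) (bit (u <ᵇ x)) _ ⟩
  bit (u <ᵇ x) + (bit (u <ᵇ y) + countAbove u xs) ≡⟨ cong (bit (u <ᵇ x) +_) (length-select-∷ (u <ᵇ_) y xs) ⟨
  bit (u <ᵇ x) + countAbove u (y ∷ xs) ≡⟨ length-select-∷ (u <ᵇ_) x (y ∷ xs) ⟨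
  countAbove u (x ∷ y ∷ xs)           ∎
  where open ≡-Reasoning

countAbove-isort : ∀ u xs → countAbove u (isort xs) ≡ countAbove u xs
countAbove-isort u []       = refl
countAbove-isort u (x ∷ xs) = begin
  countAbove u (ins x (isort xs))         ≡⟨ countAbove-ins u x (isort xs) ⟩
  countAbove u (x ∷ isort xs)             ≡⟨ length-select-∷ (u <ᵇ_) x (isort xs) ⟩
  bit (u <ᵇ x) + countAbove u (isort xs)  ≡⟨ cong (bit (u <ᵇ x) +_) (countAbove-isort u xs) ⟩
  bit (u <ᵇ x) + countAbove u xs          ≡⟨ length-select-∷ (u <ᵇ_) x xs ⟨
  countAbove u (x ∷ xs)                   ∎
  where open ≡-Reasoning

SameCounts : List ℕ → List ℕ → Set
SameCounts xs ys = ∀ u → countAbove u xs ≡ countAbove u ys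

countAbove-as-countBelow : ∀ u xs → countAbove u xs ≡ countBelow (λ i → u <ᵇ at xs i) (length xs)
countAbove-as-countBelow u xs = begin
  countAbove u xs                                             ≡⟨ cong (countAbove u) (map-at-upTo xs) ⟨
  length (select (u <ᵇ_) (map (at xs) (upTo L)))              ≡⟨ cong length (select-map (u <ᵇ_) (at xs) (upTo L)) ⟩
  length (map (at xs) (select ((u <ᵇ_) ∘ at xs) (upTo L)))    ≡⟨ length-map (at xs) (select ((u <ᵇ_) ∘ at xs) (upTo L)) ⟩
  length (select ((u <ᵇ_) ∘ at xs) (upTo L))                  ≡⟨ length-select-upTo ((u <ᵇ_) ∘ at xs) L ⟩
  countBelow (λ i → u <ᵇ at xs i) L                           ∎
  where
  open ≡-Reasoning
  L = length xs

sameClass-refl : ∀ h j → sameClass h j j ≡ true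
sameClass-refl zero    j = refl
sameClass-refl (suc h′) j = ≡ᵇ-refl (j % suc h′)

classAbove : ℕ → (ℕ → ℕ) → ℕ → ℕ → ℕ → ℕ
classAbove h f j u L = countBelow (λ i → sameClass h i j ∧ (u <ᵇ f i)) L

classAbove-chainOf : ∀ h xs j u → classAbove h (at xs) j u (length xs) ≡ countAbove u (chainOf h xs j)
classAbove-chainOf h xs j u = begin
  countBelow (λ i → S i ∧ (u <ᵇ at xs i)) L                 ≡⟨ length-select-upTo _ L ⟨
  length (select (λ i → S i ∧ (u <ᵇ at xs i)) (upTo L))
    ≡⟨ cong length (select-select S ((u <ᵇ_) ∘ at xs) (upTo L)) ⟨
  length (select ((u <ᵇ_) ∘ at xs) (select S (upTo L)))
    ≡⟨ length-map (at xs) (select ((u <ᵇ_) ∘ at xs) (select S (upTo L))) ⟨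
  length (map (at xs) (select ((u <ᵇ_) ∘ at xs) (select S (upTo L))))
                                                            ≡⟨ cong length (select-map (u <ᵇ_) (at xs) (select S (upTo L))) ⟨
  countAbove u (map (at xs) (select S (upTo L)))            ∎
  where
  open ≡-Reasoning
  L = length xs
  S : ℕ → Bool
  S i = sameClass h i j

classAbove-hsort : ∀ h′ xs j u →
  classAbove (suc h′) (at (hsort (suc h′) xs)) j u (length xs) ≡ classAbove (suc h′) (at xs) j u (length xs)
classAbove-hsort h′ xs j u = begin
  classAbove h (at (hsort h xs)) j u (length xs)
    ≡⟨ cong (classAbove h (at (hsort h xs)) j u) (length-hsort h xs) ⟨
  classAbove h (at (hsort h xs)) j u (length (hsort h xs)) ≡⟨ classAbove-chainOf h (hsort h xs) j u ⟩
  countAbove u (chainOf h (hsort h xs) j)                  ≡⟨ cong (countAbove u) (chainOf-hsort h′ xs j) ⟩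
  countAbove u (isort (chainOf h xs j))                    ≡⟨ countAbove-isort u (chainOf h xs j) ⟩
  countAbove u (chainOf h xs j)                            ≡⟨ classAbove-chainOf h xs j u ⟨
  classAbove h (at xs) j u (length xs)                     ∎
  where
  open ≡-Reasoning
  h = suc h′

countAbove-by-class : ∀ h′ u xs →
  countAbove u xs ≡ sumBelow (suc h′) (λ r → classAbove (suc h′) (at xs) r u (length xs))
countAbove-by-class h′ u xs = begin
  countAbove u xs                                      ≡⟨ countAbove-as-countBelow u xs ⟩
  countBelow (λ i → u <ᵇ at xs i) L                    ≡⟨ countBelow-by-residue h′ _ L ⟨
  sumBelow h (λ r → countBelow (λ i → hasResidue h′ r i ∧ (u <ᵇ at xs i)) L)
    ≡⟨ sumBelow-cong h _ _ (λ r r<h → countBelow-cong _ _ L (λ i _ →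
         cong (λ s → (i % h ≡ᵇ s) ∧ (u <ᵇ at xs i)) (sym (m<n⇒m%n≡m r<h)))) ⟩
  sumBelow h (λ r → classAbove h (at xs) r u L)        ∎
  where
  open ≡-Reasoning
  h = suc h′
  L = length xs

countAbove-hsort : ∀ h′ u xs → countAbove u (hsort (suc h′) xs) ≡ countAbove u xs
countAbove-hsort h′ u xs = begin
  countAbove u (hsort h xs)
    ≡⟨ countAbove-by-class h′ u (hsort h xs) ⟩
  sumBelow h (λ r → classAbove h (at (hsort h xs)) r u (length (hsort h xs)))
    ≡⟨ cong (λ L → sumBelow h (λ r → classAbove h (at (hsort h xs)) r u L)) (length-hsort h xs) ⟩
  sumBelow h (λ r → classAbove h (at (hsort h xs)) r u (length xs))
    ≡⟨ sumBelow-cong h _ _ (λ r _ → classAbove-hsort h′ xs r u) ⟩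
  sumBelow h (λ r → classAbove h (at xs) r u (length xs))
    ≡⟨ countAbove-by-class h′ u xs ⟨
  countAbove u xs ∎
  where
  open ≡-Reasoning
  h = suc h′

All-ins : ∀ {P : ℕ → Set} x xs → P x → All P xs → All P (ins x xs)
All-ins x []       px []         = px ∷ []
All-ins x (y ∷ xs) px (py ∷ pxs) with y <ᵇ x
... | true  = py ∷ All-ins x xs px pxs
... | false = px ∷ py ∷ pxs

sorted-ins : ∀ x xs → AllPairs _≤_ xs → AllPairs _≤_ (ins x xs)
sorted-ins x []       _                = [] ∷ []
sorted-ins x (y ∷ xs) (y≤xs ∷ sorted) with y <ᵇ x in y<ᵇx
... | true  = All-ins x xs (<⇒≤ (<ᵇ≡true⇒< y x y<ᵇx)) y≤xs ∷ sorted-ins x xs sorted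
... | false = (x≤y ∷ All.map (≤-trans x≤y) y≤xs) ∷ y≤xs ∷ sorted
  where
  x≤y : x ≤ y
  x≤y = <ᵇ≡false⇒≥ y x y<ᵇx

sorted-isort : ∀ xs → AllPairs _≤_ (isort xs)
sorted-isort []       = []
sorted-isort (x ∷ xs) = sorted-ins x (isort xs) (sorted-isort xs)

sorted-heads-≮ : ∀ x as y bs → AllPairs _≤_ (y ∷ bs) → length as ≡ length bs →
  SameCounts (x ∷ as) (y ∷ bs) → x ≮ y
sorted-heads-≮ x as y bs (y≤bs ∷ _) len same x<y = <-irrefl refl (begin-strict
  length bs                    <⟨ n<1+n (length bs) ⟩
  length (y ∷ bs)
    ≡⟨ cong length (filter-all (λ z → (x <ᵇ z) ≟ true) (All.map (<⇒<ᵇ≡true ∘ <-≤-trans x<y) (≤-refl ∷ y≤bs))) ⟨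
  countAbove x (y ∷ bs)        ≡⟨ same x ⟨
  countAbove x (x ∷ as)        ≡⟨ length-select-∷ (x <ᵇ_) x as ⟩
  bit (x <ᵇ x) + countAbove x as ≡⟨ cong (λ b → bit b + countAbove x as) (n<ᵇn≡false x) ⟩
  countAbove x as              ≤⟨ length-filter _ as ⟩
  length as                    ≡⟨ len ⟩
  length bs                    ∎)
  where open ≤-Reasoning

sorted-unique : ∀ xs ys → AllPairs _≤_ xs → AllPairs _≤_ ys → length xs ≡ length ys →
  SameCounts xs ys → xs ≡ ys
sorted-unique []       []       _           _           _   _    = refl
sorted-unique (x ∷ xs) (y ∷ ys) sorted-x∷xs sorted-y∷ys len same with <-cmp x y
... | tri< x<y _ _ = ⊥-elim (sorted-heads-≮ x xs y ys sorted-y∷ys (suc-injective len) same x<y)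
... | tri> _ _ y<x = ⊥-elim (sorted-heads-≮ y ys x xs sorted-x∷xs (sym (suc-injective len)) (sym ∘ same) y<x)
... | tri≈ _ refl _ = cong (x ∷_) (sorted-unique xs ys (AllPairs-tail sorted-x∷xs) (AllPairs-tail sorted-y∷ys)
    (suc-injective len) same-tail)
  where
  AllPairs-tail : ∀ {z zs} → AllPairs _≤_ (z ∷ zs) → AllPairs _≤_ zs
  AllPairs-tail (_ ∷ sorted) = sorted
  same-tail : SameCounts xs ys
  same-tail u = +-cancelˡ-≡ (bit (u <ᵇ x)) _ _
    (trans (sym (length-select-∷ (u <ᵇ_) x xs)) (trans (same u) (length-select-∷ (u <ᵇ_) x ys)))

isort-sameCounts : ∀ xs ys → length xs ≡ length ys → SameCounts xs ys → isort xs ≡ isort ys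
isort-sameCounts xs ys len same = sorted-unique (isort xs) (isort ys) (sorted-isort xs) (sorted-isort ys)
  (trans (length-isort xs) (trans len (sym (length-isort ys))))
  (λ u → trans (countAbove-isort u xs) (trans (same u) (sym (countAbove-isort u ys))))

-- Undoing a pass

largerBefore : ℕ → (ℕ → ℕ) → ℕ → ℕ
largerBefore h f j = countBelow (λ i → sameClass h i j ∧ (f j <ᵇ f i)) j

leftLarger≡largerBefore : ∀ h xs j → leftLarger h xs j ≡ largerBefore h (at xs) j
leftLarger≡largerBefore h xs j = length-select-upTo (λ i → sameClass h i j ∧ (at xs j <ᵇ at xs i)) j

classAbove-split : ∀ h f j u k →
  classAbove h f j u (suc j + k) ≡
    classAbove h f j u j + bit (u <ᵇ f j) + countBelow (λ i → sameClass h (suc j + i) j ∧ (u <ᵇ f (suc j + i))) k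
classAbove-split h f j u k =
  trans (countBelow-+ P (suc j) k)
    (cong (λ b → countBelow P j + bit (b ∧ (u <ᵇ f j)) + countBelow (λ i → P (suc j + i)) k) (sameClass-refl h j))
  where
  P : ℕ → Bool
  P i = sameClass h i j ∧ (u <ᵇ f i)

-- g j is counted on the right but f j is not counted on the left; all other terms are dominated.
classAbove-< : ∀ h f g j k →
  (∀ i → i < k → f (suc j + i) ≡ g (suc j + i)) →
  largerBefore h f j ≡ largerBefore h g j →
  f j < g j →
  classAbove h f j (f j) (suc j + k) < classAbove h g j (f j) (suc j + k)
classAbove-< h f g j k agree same fj<gj = begin-strict
  classAbove h f j u (suc j + k)          ≡⟨ classAbove-split h f j u k ⟩
  largerBefore h f j + bit (u <ᵇ u) + R f ≡⟨ cong (λ b → largerBefore h f j + bit b + R f) (n<ᵇn≡false u) ⟩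
  largerBefore h f j + 0 + R f            ≡⟨ cong₂ _+_ (trans (+-identityʳ _) same) right-same ⟩
  largerBefore h g j + R g                ≤⟨ +-monoˡ-≤ (R g) before-≤ ⟩
  classAbove h g j u j + R g              <⟨ +-monoˡ-< (R g) (m<m+n _ z<s) ⟩
  classAbove h g j u j + 1 + R g          ≡⟨ cong (λ b → classAbove h g j u j + bit b + R g) (<⇒<ᵇ≡true fj<gj) ⟨
  classAbove h g j u j + bit (u <ᵇ g j) + R g ≡⟨ classAbove-split h g j u k ⟨
  classAbove h g j u (suc j + k)          ∎
  where
  open ≤-Reasoning
  u = f j
  R : (ℕ → ℕ) → ℕ
  R f′ = countBelow (λ i → sameClass h (suc j + i) j ∧ (u <ᵇ f′ (suc j + i))) k
  right-same : R f ≡ R g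
  right-same = countBelow-cong _ _ k (λ i i<k → cong (λ v → sameClass h (suc j + i) j ∧ (u <ᵇ v)) (agree i i<k))
  before-≤ : largerBefore h g j ≤ classAbove h g j u j
  before-≤ = countBelow-mono _ _ j (λ i _ → ∧-monoʳ-≡true (sameClass h i j)
    (λ gj<gi → <⇒<ᵇ≡true (<-trans fj<gj (<ᵇ≡true⇒< (g j) (g i) gj<gi))))

entry-determined : ∀ h f g j k →
  (∀ i → i < k → f (suc j + i) ≡ g (suc j + i)) →
  (∀ u → classAbove h f j u (suc j + k) ≡ classAbove h g j u (suc j + k)) →
  largerBefore h f j ≡ largerBefore h g j →
  f j ≡ g j
entry-determined h f g j k agree same-above same-before with <-cmp (f j) (g j)
... | tri< fj<gj _ _ =
  ⊥-elim (<-irrefl (same-above (f j)) (classAbove-< h f g j k agree same-before fj<gj))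
... | tri≈ _ fj≡gj _ = fj≡gj
... | tri> _ _ gj<fj =
  ⊥-elim (<-irrefl (sym (same-above (g j)))
    (classAbove-< h g f j k (λ i i<k → sym (agree i i<k)) (sym same-before) gj<fj))

values-determined : ∀ h f g L →
  (∀ j u → j < L → classAbove h f j u L ≡ classAbove h g j u L) →
  (∀ j → j < L → largerBefore h f j ≡ largerBefore h g j) →
  ∀ j → j < L → f j ≡ g j
values-determined h f g L same-above same-before j j<L = go L j j<L (m≤n+m L j)
  where
  go : ∀ d j → j < L → L ≤ j + d → f j ≡ g j
  go zero    j j<L L≤j+0 = ⊥-elim (<-irrefl refl (<-≤-trans j<L (subst (L ≤_) (+-identityʳ j) L≤j+0)))
  go (suc d) j j<L L≤j+d = entry-determined h f g j k
    (λ i i<k → go d (suc j + i) (subst (suc j + i <_) L≡ (+-monoʳ-< (suc j) i<k))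
      (≤-trans L≤j+d (≤-trans (≤-reflexive (+-suc j d)) (s≤s (+-monoˡ-≤ d (m≤m+n j i))))))
    (λ u → subst (λ M → classAbove h f j u M ≡ classAbove h g j u M) (sym L≡) (same-above j u j<L))
    (same-before j j<L)
    where
    k = L ∸ suc j
    L≡ : suc j + k ≡ L
    L≡ = m+[n∸m]≡n j<L

-- The pass preserves the multiset of every h-chain, so `values-determined` applies.
hsort-injective : ∀ h′ xs ys → length xs ≡ length ys →
  hsort (suc h′) xs ≡ hsort (suc h′) ys →
  map (leftLarger (suc h′) xs) (upTo (length xs)) ≡ map (leftLarger (suc h′) ys) (upTo (length xs)) →
  xs ≡ ys
hsort-injective h′ xs ys len same-sorted same-table =
  ≡-from-at xs ys len (values-determined h (at xs) (at ys) L same-above same-before)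
  where
  h = suc h′
  L = length xs
  same-above : ∀ j u → j < L → classAbove h (at xs) j u L ≡ classAbove h (at ys) j u L
  same-above j u _ = begin
    classAbove h (at xs) j u L                 ≡⟨ classAbove-hsort h′ xs j u ⟨
    classAbove h (at (hsort h xs)) j u L       ≡⟨ cong (λ zs → classAbove h (at zs) j u L) same-sorted ⟩
    classAbove h (at (hsort h ys)) j u L       ≡⟨ cong (classAbove h (at (hsort h ys)) j u) len ⟩
    classAbove h (at (hsort h ys)) j u (length ys) ≡⟨ classAbove-hsort h′ ys j u ⟩
    classAbove h (at ys) j u (length ys)       ≡⟨ cong (classAbove h (at ys) j u) len ⟨
    classAbove h (at ys) j u L                 ∎
    where open ≡-Reasoning
  same-before : ∀ j → j < L → largerBefore h (at xs) j ≡ largerBefore h (at ys) j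
  same-before j j<L = begin
    largerBefore h (at xs) j                   ≡⟨ leftLarger≡largerBefore h xs j ⟨
    leftLarger h xs j                          ≡⟨ at-map-upTo (leftLarger h xs) L j j<L ⟨
    at (map (leftLarger h xs) (upTo L)) j      ≡⟨ cong (λ zs → at zs j) same-table ⟩
    at (map (leftLarger h ys) (upTo L)) j      ≡⟨ at-map-upTo (leftLarger h ys) L j j<L ⟩
    leftLarger h ys j                          ≡⟨ leftLarger≡largerBefore h ys j ⟩
    largerBefore h (at ys) j                   ∎
    where open ≡-Reasoning

-- Inversion tables of a run

shellsort : List ℕ → List ℕ → List ℕ
shellsort []       xs = xs
shellsort (h ∷ hs) xs = shellsort hs (hsort h xs)

inversionTable : List ℕ → List ℕ → List ℕ
inversionTable []       xs = []
inversionTable (h ∷ hs) xs = map (leftLarger h xs) (upTo (length xs)) ++ inversionTable hs (hsort h xs)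

shellsort-sameCounts : ∀ hs → All (1 ≤_) hs → last hs ≡ just 1 →
  ∀ xs ys → length xs ≡ length ys → SameCounts xs ys → shellsort hs xs ≡ shellsort hs ys
shellsort-sameCounts (h ∷ []) _ last≡1 xs ys len same rewrite just-injective last≡1 =
  trans (hsort-1 xs) (trans (isort-sameCounts xs ys len same) (sym (hsort-1 ys)))
shellsort-sameCounts (zero ∷ _ ∷ _) (() ∷ _)
shellsort-sameCounts (suc h′ ∷ h₂ ∷ hs) (_ ∷ hs≥1) last≡1 xs ys len same =
  shellsort-sameCounts (h₂ ∷ hs) hs≥1 last≡1 (hsort (suc h′) xs) (hsort (suc h′) ys)
    (length-hsort-cong (suc h′) xs ys len)
    (λ u → trans (countAbove-hsort h′ u xs) (trans (same u) (sym (countAbove-hsort h′ u ys))))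

++-injective : {A : Set} (xs ys : List A) {zs ws : List A} →
  length xs ≡ length ys → xs ++ zs ≡ ys ++ ws → xs ≡ ys × zs ≡ ws
++-injective []       []       _   eq = refl , eq
++-injective (x ∷ xs) (y ∷ ys) len eq with ∷-injective eq
... | refl , eq′ with ++-injective xs ys (suc-injective len) eq′
...   | refl , zs≡ws = refl , zs≡ws

inversionTable-injective : ∀ hs → All (1 ≤_) hs → ∀ xs ys → length xs ≡ length ys →
  shellsort hs xs ≡ shellsort hs ys → inversionTable hs xs ≡ inversionTable hs ys → xs ≡ ys
inversionTable-injective []            _           xs ys _   same-sorted _ = same-sorted
inversionTable-injective (zero ∷ _)    (() ∷ _)
inversionTable-injective (suc h′ ∷ hs) (_ ∷ hs≥1) xs ys len same-sorted same-table =
  hsort-injective h′ xs ys len same-pass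
    (trans (proj₁ split) (cong (map (leftLarger h ys) ∘ upTo) (sym len)))
  where
  h = suc h′
  split : map (leftLarger h xs) (upTo (length xs)) ≡ map (leftLarger h ys) (upTo (length ys)) ×
          inversionTable hs (hsort h xs) ≡ inversionTable hs (hsort h ys)
  split = ++-injective (map (leftLarger h xs) (upTo (length xs))) (map (leftLarger h ys) (upTo (length ys)))
    (trans (length-map-upTo _ (length xs)) (trans len (sym (length-map-upTo _ (length ys)))))
    same-table
  same-pass : hsort h xs ≡ hsort h ys
  same-pass = inversionTable-injective hs hs≥1 (hsort h xs) (hsort h ys) (length-hsort-cong h xs ys len)
    same-sorted (proj₂ split)

inversionTable-determines : ∀ hs → All (1 ≤_) hs → last hs ≡ just 1 →
  ∀ xs ys → length xs ≡ length ys → SameCounts xs ys →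
  inversionTable hs xs ≡ inversionTable hs ys → xs ≡ ys
inversionTable-determines hs hs≥1 last≡1 xs ys len same =
  inversionTable-injective hs hs≥1 xs ys len (shellsort-sameCounts hs hs≥1 last≡1 xs ys len same)

sum-map-+1 : {A : Set} (f : A → ℕ) (xs : List A) → sum (map (λ x → f x + 1) xs) ≡ sum (map f xs) + length xs
sum-map-+1 f []       = refl
sum-map-+1 f (x ∷ xs) = trans (cong (f x + 1 +_) (sum-map-+1 f xs)) (+-CS.interchange (f x) 1 (sum (map f xs)) (length xs))

passCost≡ : ∀ h xs → passCost h xs ≡ sum (map (leftLarger h xs) (upTo (length xs))) + length xs
passCost≡ h xs = trans (sum-map-+1 (leftLarger h xs) (upTo (length xs)))
  (cong (sum (map (leftLarger h xs) (upTo (length xs))) +_) (length-upTo (length xs)))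

shellCost≡ : ∀ hs xs → shellCost hs xs ≡ length hs * length xs + sum (inversionTable hs xs)
shellCost≡ []       xs = refl
shellCost≡ (h ∷ hs) xs = begin
  passCost h xs + shellCost hs (hsort h xs)
    ≡⟨ cong₂ _+_ (passCost≡ h xs) (shellCost≡ hs (hsort h xs)) ⟩
  A + L + (length hs * length (hsort h xs) + B)
    ≡⟨ cong (λ m → A + L + (length hs * m + B)) (length-hsort h xs) ⟩
  A + L + (length hs * L + B)       ≡⟨ cong (_+ (length hs * L + B)) (+-comm A L) ⟩
  L + A + (length hs * L + B)       ≡⟨ +-CS.interchange L A (length hs * L) B ⟩
  L + length hs * L + (A + B)
    ≡⟨ cong (L + length hs * L +_) (sum-++ (map (leftLarger h xs) (upTo L)) (inversionTable hs (hsort h xs))) ⟨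
  suc (length hs) * L + sum (inversionTable (h ∷ hs) xs) ∎
  where
  open ≡-Reasoning
  L = length xs
  A = sum (map (leftLarger h xs) (upTo L))
  B = sum (inversionTable hs (hsort h xs))

length-inversionTable : ∀ hs xs → length (inversionTable hs xs) ≡ length hs * length xs
length-inversionTable []       xs = refl
length-inversionTable (h ∷ hs) xs = begin
  length (map (leftLarger h xs) (upTo (length xs)) ++ inversionTable hs (hsort h xs))
    ≡⟨ length-++ (map (leftLarger h xs) (upTo (length xs))) ⟩
  length (map (leftLarger h xs) (upTo (length xs))) + length (inversionTable hs (hsort h xs))
    ≡⟨ cong₂ _+_ (length-map-upTo _ (length xs))
                 (trans (length-inversionTable hs (hsort h xs)) (cong (length hs *_) (length-hsort h xs))) ⟩
  length xs + length hs * length xs ∎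
  where open ≡-Reasoning

countAbove-↭ : ∀ u {xs ys} → xs ↭ ys → countAbove u xs ≡ countAbove u ys
countAbove-↭ u = ↭-length ∘ filter-↭ (λ x → (u <ᵇ x) ≟ true)

All-concatMap : {A B : Set} {P : A → Set} {Q : B → Set} (f : A → List B) {xs : List A} →
  (∀ {x} → P x → All Q (f x)) → All P xs → All Q (concatMap f xs)
All-concatMap f g = All.concat⁺ ∘ All.map⁺ ∘ All.map g

insertions-↭ : ∀ x σ → All (_↭ x ∷ σ) (insertions x σ)
insertions-↭ x []       = ↭-refl ∷ []
insertions-↭ x (y ∷ ys) =
  ↭-refl ∷ All.map⁺ (All.map (λ w↭ → ↭-trans (↭-prep y w↭) (↭-swap y x ↭-refl)) (insertions-↭ x ys))

permutations-↭ : ∀ xs → All (_↭ xs) (permutations xs)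
permutations-↭ []       = ↭-refl ∷ []
permutations-↭ (x ∷ xs) =
  All-concatMap (insertions x) (λ σ↭ → All.map (λ w↭ → ↭-trans w↭ (↭-prep x σ↭)) (insertions-↭ x _))
    (permutations-↭ xs)

length-concatMap-const : {A B : Set} (f : A → List B) (xs : List A) (k : ℕ) →
  All (λ x → length (f x) ≡ k) xs → length (concatMap f xs) ≡ length xs * k
length-concatMap-const f []       k []           = refl
length-concatMap-const f (x ∷ xs) k (len ∷ lens) =
  trans (length-++ (f x)) (cong₂ _+_ len (length-concatMap-const f xs k lens))

length-insertions : ∀ x σ → length (insertions x σ) ≡ suc (length σ)
length-insertions x []       = refl
length-insertions x (y ∷ ys) = cong suc (trans (length-map (y ∷_) (insertions x ys)) (length-insertions x ys))

length-permutations : ∀ xs → length (permutations xs) ≡ length xs !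
length-permutations []       = refl
length-permutations (x ∷ xs) = begin
  length (concatMap (insertions x) (permutations xs))
    ≡⟨ length-concatMap-const (insertions x) (permutations xs) (suc (length xs))
         (All.map (λ {σ} σ↭ → trans (length-insertions x σ) (cong suc (↭-length σ↭))) (permutations-↭ xs)) ⟩
  length (permutations xs) * suc (length xs) ≡⟨ cong (_* suc (length xs)) (length-permutations xs) ⟩
  length xs ! * suc (length xs)             ≡⟨ *-comm (length xs !) (suc (length xs)) ⟩
  suc (length xs) * length xs !             ∎
  where open ≡-Reasoning

removeFirst : ℕ → List ℕ → List ℕ
removeFirst x []       = []
removeFirst x (y ∷ ys) = if y ≡ᵇ x then ys else y ∷ removeFirst x ys

removeFirst-insertions : ∀ x σ → All (_≢ x) σ → All (λ w → removeFirst x w ≡ σ) (insertions x σ)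
removeFirst-insertions x []       []          = cong (λ b → if b then [] else x ∷ []) (≡ᵇ-refl x) ∷ []
removeFirst-insertions x (y ∷ ys) (y≢x ∷ ys∌x) =
  cong (λ b → if b then y ∷ ys else x ∷ removeFirst x (y ∷ ys)) (≡ᵇ-refl x) ∷
  All.map⁺ (All.map (λ {w} eq →
      trans (cong (λ b → if b then w else y ∷ removeFirst x w) (≢⇒≡ᵇ≡false y x y≢x)) (cong (y ∷_) eq))
                    (removeFirst-insertions x ys ys∌x))

insertions-unique : ∀ x σ → All (_≢ x) σ → Unique (insertions x σ)
insertions-unique x []       []           = [] ∷ []
insertions-unique x (y ∷ ys) (y≢x ∷ ys∌x) =
  All.map⁺ (All.universal (λ w head≡ → y≢x (sym (∷-injectiveˡ head≡))) (insertions x ys)) ∷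
  Unique.map⁺ ∷-injectiveʳ (insertions-unique x ys ys∌x)

removeFirst-concatMap : ∀ x ps → All (All (_≢ x)) ps →
  All (λ w → removeFirst x w ∈ ps) (concatMap (insertions x) ps)
removeFirst-concatMap x []       []             = []
removeFirst-concatMap x (σ ∷ ps) (σ∌x ∷ ps∌x) = All.++⁺
  (All.map here (removeFirst-insertions x σ σ∌x))
  (All.map there (removeFirst-concatMap x ps ps∌x))

-- Insertions of x into different lists avoiding x are different, since removing x recovers the list.
concatMap-insertions-unique : ∀ x ps → Unique ps → All (All (_≢ x)) ps → Unique (concatMap (insertions x) ps)
concatMap-insertions-unique x []       _             _              = []
concatMap-insertions-unique x (σ ∷ ps) (σ∉ps ∷ ps!) (σ∌x ∷ ps∌x) =
  Unique.++⁺ (insertions-unique x σ σ∌x) (concatMap-insertions-unique x ps ps! ps∌x) disjoint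
  where
  disjoint : ∀ {w} → w ∈ insertions x σ × w ∈ concatMap (insertions x) ps → ⊥
  disjoint (w∈σ , w∈ps) = All.lookup σ∉ps
    (subst (_∈ ps) (All.lookup (removeFirst-insertions x σ σ∌x) w∈σ) (All.lookup (removeFirst-concatMap x ps ps∌x) w∈ps))
    refl

permutations-unique : ∀ xs → Unique xs → Unique (permutations xs)
permutations-unique []       _           = [] ∷ []
permutations-unique (x ∷ xs) (x∉xs ∷ xs!) =
  concatMap-insertions-unique x (permutations xs) (permutations-unique xs xs!)
    (All.map (λ σ↭xs → All-resp-↭ (↭-sym σ↭xs) (All.map (_∘ sym) x∉xs)) (permutations-↭ xs))

Permutation : ℕ → List ℕ → Set
Permutation n σ = length σ ≡ n × SameCounts σ (map suc (upTo n))

permsOf-permutation : ∀ n → All (Permutation n) (permsOf n)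
permsOf-permutation n = All.map (λ σ↭ → trans (↭-length σ↭) (length-map-upTo suc n) , (λ u → countAbove-↭ u σ↭))
  (permutations-↭ (map suc (upTo n)))

permsOf-unique : ∀ n → Unique (permsOf n)
permsOf-unique n = permutations-unique (map suc (upTo n)) (Unique.map⁺ suc-injective (Unique.upTo⁺ n))

length-permsOf : ∀ n → length (permsOf n) ≡ n !
length-permsOf n = trans (length-permutations (map suc (upTo n))) (cong _! (length-map-upTo suc n))

-- Counting lists with bounded sum

Bounded : ℕ → ℕ → List ℕ → Set
Bounded K T v = length v ≡ K × sum v ≤ T

zeroHeadTails : List (List ℕ) → List (List ℕ)
zeroHeadTails []                  = []
zeroHeadTails ([] ∷ vs)           = zeroHeadTails vs
zeroHeadTails ((zero ∷ v) ∷ vs)   = v ∷ zeroHeadTails vs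
zeroHeadTails ((suc _ ∷ _) ∷ vs)  = zeroHeadTails vs

decrementedHeads : List (List ℕ) → List (List ℕ)
decrementedHeads []                 = []
decrementedHeads ([] ∷ vs)          = decrementedHeads vs
decrementedHeads ((zero ∷ _) ∷ vs)  = decrementedHeads vs
decrementedHeads ((suc a ∷ v) ∷ vs) = (a ∷ v) ∷ decrementedHeads vs

length-split-heads : ∀ K T vs → All (Bounded (suc K) T) vs →
  length vs ≡ length (zeroHeadTails vs) + length (decrementedHeads vs)
length-split-heads K T []                  []      = refl
length-split-heads K T ((zero ∷ _) ∷ vs)  (_ ∷ bs) = cong suc (length-split-heads K T vs bs)
length-split-heads K T ((suc _ ∷ _) ∷ vs) (_ ∷ bs) = trans (cong suc (length-split-heads K T vs bs)) (sym (+-suc _ _))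

zeroHeadTails-bounded : ∀ K T vs → All (Bounded (suc K) T) vs → All (Bounded K T) (zeroHeadTails vs)
zeroHeadTails-bounded K T []                  []                = []
zeroHeadTails-bounded K T ((zero ∷ _) ∷ vs)  ((len , s) ∷ bs) = (suc-injective len , s) ∷ zeroHeadTails-bounded K T vs bs
zeroHeadTails-bounded K T ((suc _ ∷ _) ∷ vs) (_ ∷ bs)          = zeroHeadTails-bounded K T vs bs

decrementedHeads-bounded : ∀ K T vs → All (Bounded (suc K) (suc T)) vs → All (Bounded (suc K) T) (decrementedHeads vs)
decrementedHeads-bounded K T []                  []                    = []
decrementedHeads-bounded K T ((zero ∷ _) ∷ vs)  (_ ∷ bs)              = decrementedHeads-bounded K T vs bs
decrementedHeads-bounded K T ((suc _ ∷ _) ∷ vs) ((len , s≤s s) ∷ bs) = (len , s) ∷ decrementedHeads-bounded K T vs bs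

decrementedHeads-sum0 : ∀ K vs → All (Bounded (suc K) 0) vs → decrementedHeads vs ≡ []
decrementedHeads-sum0 K []                 []      = refl
decrementedHeads-sum0 K ((zero ∷ _) ∷ vs) (_ ∷ bs) = decrementedHeads-sum0 K vs bs

zeroHeadTails-∌ : ∀ t vs → All ((zero ∷ t) ≢_) vs → All (t ≢_) (zeroHeadTails vs)
zeroHeadTails-∌ t []                  []       = []
zeroHeadTails-∌ t ([] ∷ vs)           (_ ∷ ns) = zeroHeadTails-∌ t vs ns
zeroHeadTails-∌ t ((zero ∷ _) ∷ vs)  (n ∷ ns) = (n ∘′ cong (zero ∷_)) ∷ zeroHeadTails-∌ t vs ns
zeroHeadTails-∌ t ((suc _ ∷ _) ∷ vs) (_ ∷ ns) = zeroHeadTails-∌ t vs ns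

decrementedHeads-∌ : ∀ a t vs → All ((suc a ∷ t) ≢_) vs → All ((a ∷ t) ≢_) (decrementedHeads vs)
decrementedHeads-∌ a t []                  []       = []
decrementedHeads-∌ a t ([] ∷ vs)           (_ ∷ ns) = decrementedHeads-∌ a t vs ns
decrementedHeads-∌ a t ((zero ∷ _) ∷ vs)  (_ ∷ ns) = decrementedHeads-∌ a t vs ns
decrementedHeads-∌ a t ((suc _ ∷ _) ∷ vs) (n ∷ ns) = (n ∘′ cong incrementHead) ∷ decrementedHeads-∌ a t vs ns
  where
  incrementHead : List ℕ → List ℕ
  incrementHead []       = []
  incrementHead (b ∷ bs) = suc b ∷ bs

zeroHeadTails-unique : ∀ vs → Unique vs → Unique (zeroHeadTails vs)
zeroHeadTails-unique []                  []       = []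
zeroHeadTails-unique ([] ∷ vs)           (_ ∷ u) = zeroHeadTails-unique vs u
zeroHeadTails-unique ((zero ∷ t) ∷ vs)  (n ∷ u) = zeroHeadTails-∌ t vs n ∷ zeroHeadTails-unique vs u
zeroHeadTails-unique ((suc _ ∷ _) ∷ vs) (_ ∷ u) = zeroHeadTails-unique vs u

decrementedHeads-unique : ∀ vs → Unique vs → Unique (decrementedHeads vs)
decrementedHeads-unique []                  []       = []
decrementedHeads-unique ([] ∷ vs)           (_ ∷ u) = decrementedHeads-unique vs u
decrementedHeads-unique ((zero ∷ _) ∷ vs)  (_ ∷ u) = decrementedHeads-unique vs u
decrementedHeads-unique ((suc a ∷ t) ∷ vs) (n ∷ u) = decrementedHeads-∌ a t vs n ∷ decrementedHeads-unique vs u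

-- There are C(T+K, K) lists of length K with sum at most T, and C(T+K, K)·q^T is a single
-- term of the binomial expansion of (1+q)^(T+K).
unique-bounded-count : ∀ q K T vs → Unique vs → All (Bounded K T) vs → length vs * q ^ T ≤ suc q ^ (T + K)
unique-bounded-count q zero    T []             _           _  = z≤n
unique-bounded-count q zero    T (v ∷ [])       _           _  = begin
  1 * q ^ T     ≡⟨ *-identityˡ (q ^ T) ⟩
  q ^ T         ≤⟨ ^-monoˡ-≤ T (n≤1+n q) ⟩
  suc q ^ T     ≡⟨ cong (suc q ^_) (+-identityʳ T) ⟨
  suc q ^ (T + 0) ∎
  where open ≤-Reasoning
unique-bounded-count q zero    T (v ∷ w ∷ _) ((v≢w ∷ _) ∷ _) ((len-v , _) ∷ (len-w , _) ∷ _) =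
  ⊥-elim (v≢w (trans (length≡0⇒[] v len-v) (sym (length≡0⇒[] w len-w))))
  where
  length≡0⇒[] : ∀ (x : List ℕ) → length x ≡ 0 → x ≡ []
  length≡0⇒[] [] _ = refl
unique-bounded-count q (suc K) zero    vs u bs = begin
  length vs * 1                      ≡⟨ cong (_* 1) (length-split-heads K 0 vs bs) ⟩
  (Z + length (decrementedHeads vs)) * 1 ≡⟨ cong (λ d → (Z + length d) * 1) (decrementedHeads-sum0 K vs bs) ⟩
  (Z + 0) * 1                        ≡⟨ cong (_* 1) (+-identityʳ Z) ⟩
  Z * q ^ 0
    ≤⟨ unique-bounded-count q K zero (zeroHeadTails vs) (zeroHeadTails-unique vs u) (zeroHeadTails-bounded K 0 vs bs) ⟩
  suc q ^ K                          ≤⟨ m≤n*m (suc q ^ K) (suc q) ⟩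
  suc q ^ suc K                      ∎
  where
  open ≤-Reasoning
  Z = length (zeroHeadTails vs)
unique-bounded-count q (suc K) (suc T) vs u bs = begin
  length vs * q ^ suc T              ≡⟨ cong (_* q ^ suc T) (length-split-heads K (suc T) vs bs) ⟩
  (Z + D) * q ^ suc T                ≡⟨ *-distribʳ-+ (q ^ suc T) Z D ⟩
  Z * q ^ suc T + D * (q * q ^ T)    ≡⟨ cong (Z * q ^ suc T +_) (*-CS.x∙yz≈y∙xz D q (q ^ T)) ⟩
  Z * q ^ suc T + q * (D * q ^ T)
    ≤⟨ +-mono-≤ (unique-bounded-count q K (suc T) (zeroHeadTails vs) (zeroHeadTails-unique vs u)
                                      (zeroHeadTails-bounded K (suc T) vs bs))
                (*-monoʳ-≤ q (unique-bounded-count q (suc K) T (decrementedHeads vs) (decrementedHeads-unique vs u)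
                                                   (decrementedHeads-bounded K T vs bs))) ⟩
  suc q ^ (suc T + K) + q * suc q ^ (T + suc K) ≡⟨ cong (λ e → suc q ^ (suc T + K) + q * suc q ^ e) (+-suc T K) ⟩
  suc q ^ suc (suc T + K)            ≡⟨ cong (suc q ^_) (+-suc (suc T) K) ⟨
  suc q ^ (suc T + suc K)            ∎
  where
  open ≤-Reasoning
  Z = length (zeroHeadTails vs)
  D = length (decrementedHeads vs)

unique-map-injectiveOn : {A B : Set} {P : A → Set} (f : A → B) {xs : List A} → Unique xs → All P xs →
  (∀ {x y} → P x → P y → f x ≡ f y → x ≡ y) → Unique (map f xs)
unique-map-injectiveOn f []                   []         _      = []
unique-map-injectiveOn f {x ∷ xs} (x∉xs ∷ xs!) (px ∷ pxs) inj =
  All.map⁺ (All.zipWith (λ (x≢y , py) fx≡fy → x≢y (inj px py fx≡fy)) (x∉xs , pxs)) ∷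
  unique-map-injectiveOn f xs! pxs inj

^-distribʳ-* : ∀ m n k → (m * n) ^ k ≡ m ^ k * n ^ k
^-distribʳ-* m n zero    = refl
^-distribʳ-* m n (suc k) = begin
  m * n * (m * n) ^ k     ≡⟨ cong (m * n *_) (^-distribʳ-* m n k) ⟩
  m * n * (m ^ k * n ^ k) ≡⟨ *-CS.interchange m n (m ^ k) (n ^ k) ⟩
  m * m ^ k * (n * n ^ k) ∎
  where open ≡-Reasoning

m≤m^n : ∀ m n → 1 ≤ m → 1 ≤ n → m ≤ m ^ n
m≤m^n m (suc n) 1≤m _ = begin
  m         ≡⟨ *-identityʳ m ⟨
  m * 1     ≡⟨ cong (m *_) (^-zeroˡ n) ⟨
  m * 1 ^ n ≤⟨ *-monoʳ-≤ m (^-monoˡ-≤ n 1≤m) ⟩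
  m * m ^ n ∎
  where open ≤-Reasoning

0^n≡0 : ∀ n → 1 ≤ n → 0 ^ n ≡ 0
0^n≡0 (suc n) _ = refl

[1+q]*[q∸[1+k]]≤q*[q∸k] : ∀ q k → suc q * (q ∸ suc k) ≤ q * (q ∸ k)
[1+q]*[q∸[1+k]]≤q*[q∸k] q k with <-cmp k q
... | tri< k<q _ _ = begin
  suc q * (q ∸ suc k)       ≤⟨ +-monoˡ-≤ (q * (q ∸ suc k)) (m∸n≤m q (suc k)) ⟩
  q + q * (q ∸ suc k)       ≡⟨ *-suc q (q ∸ suc k) ⟨
  q * suc (q ∸ suc k)       ≡⟨ cong (q *_) (+-∸-assoc 1 k<q) ⟨
  q * (q ∸ k)               ∎
  where open ≤-Reasoning
... | tri≈ _ refl _ rewrite n∸n≡0 k | m≤n⇒m∸n≡0 (n≤1+n k) | *-zeroʳ (suc k) = z≤n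
... | tri> _ _ q<k  rewrite m≤n⇒m∸n≡0 (m≤n⇒m≤1+n (<⇒≤ q<k)) | *-zeroʳ (suc q) = z≤n

[1+q]^k*[q∸k]≤q^[1+k] : ∀ q k → suc q ^ k * (q ∸ k) ≤ q ^ suc k
[1+q]^k*[q∸k]≤q^[1+k] q zero    = ≤-reflexive (trans (+-identityʳ q) (sym (*-identityʳ q)))
[1+q]^k*[q∸k]≤q^[1+k] q (suc k) = begin
  suc q * suc q ^ k * (q ∸ suc k)   ≡⟨ *-CS.xy∙z≈y∙xz (suc q) (suc q ^ k) (q ∸ suc k) ⟩
  suc q ^ k * (suc q * (q ∸ suc k)) ≤⟨ *-monoʳ-≤ (suc q ^ k) ([1+q]*[q∸[1+k]]≤q*[q∸k] q k) ⟩
  suc q ^ k * (q * (q ∸ k))         ≡⟨ *-CS.x∙yz≈y∙xz (suc q ^ k) q (q ∸ k) ⟩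
  q * (suc q ^ k * (q ∸ k))         ≤⟨ *-monoʳ-≤ q ([1+q]^k*[q∸k]≤q^[1+k] q k) ⟩
  q * q ^ suc k                     ∎
  where open ≤-Reasoning

[1+q]^k≤2*q^k : ∀ q k → 2 * k ≤ q → suc q ^ k ≤ 2 * q ^ k
[1+q]^k≤2*q^k zero     zero    _    = s≤s z≤n
[1+q]^k≤2*q^k q@(suc _) k      2k≤q = *-cancelʳ-≤ (suc q ^ k) (2 * q ^ k) q (begin
  suc q ^ k * q                 ≤⟨ *-monoʳ-≤ (suc q ^ k) q≤2[q∸k] ⟩
  suc q ^ k * (2 * (q ∸ k))     ≡⟨ *-CS.x∙yz≈y∙xz (suc q ^ k) 2 (q ∸ k) ⟩
  2 * (suc q ^ k * (q ∸ k))     ≤⟨ *-monoʳ-≤ 2 ([1+q]^k*[q∸k]≤q^[1+k] q k) ⟩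
  2 * (q * q ^ k)               ≡⟨ cong (2 *_) (*-comm q (q ^ k)) ⟩
  2 * (q ^ k * q)               ≡⟨ *-assoc 2 (q ^ k) q ⟨
  2 * q ^ k * q                 ∎)
  where
  open ≤-Reasoning
  k+k≤q : k + k ≤ q
  k+k≤q = subst (_≤ q) (cong (k +_) (+-identityʳ k)) 2k≤q
  q≤2[q∸k] : q ≤ 2 * (q ∸ k)
  q≤2[q∸k] = begin
    q                     ≡⟨ m+[n∸m]≡n (≤-trans (m≤m+n k k) k+k≤q) ⟨
    k + (q ∸ k)           ≤⟨ +-monoˡ-≤ (q ∸ k) (m+n≤o⇒m≤o∸n k k+k≤q) ⟩
    (q ∸ k) + (q ∸ k)     ≡⟨ cong ((q ∸ k) +_) (+-identityʳ (q ∸ k)) ⟨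
    2 * (q ∸ k)           ∎

-- Write n = e + 2k with e ≤ 1 and apply the previous bound to each of the three factors.
[1+n]^n≤8*n^n : ∀ n → suc n ^ n ≤ 8 * n ^ n
[1+n]^n≤8*n^n zero          = s≤s z≤n
[1+n]^n≤8*n^n (suc zero)    = s≤s (s≤s z≤n)
[1+n]^n≤8*n^n n@(suc (suc _)) = begin
  suc n ^ n                                   ≡⟨ cong (suc n ^_) n≡e+k+k ⟩
  suc n ^ (e + (k + k))                       ≡⟨ ^-distribˡ-+-* (suc n) e (k + k) ⟩
  suc n ^ e * suc n ^ (k + k)                 ≡⟨ cong (suc n ^ e *_) (^-distribˡ-+-* (suc n) k k) ⟩
  suc n ^ e * (suc n ^ k * suc n ^ k)
    ≤⟨ *-mono-≤ ([1+q]^k≤2*q^k n e 2e≤n) (*-mono-≤ ([1+q]^k≤2*q^k n k 2k≤n) ([1+q]^k≤2*q^k n k 2k≤n)) ⟩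
  2 * n ^ e * (2 * n ^ k * (2 * n ^ k))
    ≡⟨ solve 2 (λ a b → con 2 :* a :* (con 2 :* b :* (con 2 :* b)) := con 8 :* (a :* (b :* b))) refl (n ^ e) (n ^ k) ⟩
  8 * (n ^ e * (n ^ k * n ^ k))               ≡⟨ cong (λ m → 8 * (n ^ e * m)) (^-distribˡ-+-* n k k) ⟨
  8 * (n ^ e * n ^ (k + k))                   ≡⟨ cong (8 *_) (^-distribˡ-+-* n e (k + k)) ⟨
  8 * n ^ (e + (k + k))                       ≡⟨ cong (λ m → 8 * n ^ m) n≡e+k+k ⟨
  8 * n ^ n                                   ∎
  where
  open ≤-Reasoning
  k = n / 2
  e = n % 2
  n≡e+k+k : n ≡ e + (k + k)
  n≡e+k+k = trans (m≡m%n+[m/n]*n n 2) (cong (e +_) (trans (*-comm k 2) (cong (k +_) (+-identityʳ k))))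
  2k≤n : 2 * k ≤ n
  2k≤n = subst₂ _≤_ (cong (k +_) (sym (+-identityʳ k))) (sym n≡e+k+k) (m≤n+m (k + k) e)
  2e≤n : 2 * e ≤ n
  2e≤n = ≤-trans (*-monoʳ-≤ 2 (s≤s⁻¹ (m%n<n n 2))) (s≤s (s≤s z≤n))

n^n≤8^n*n! : ∀ n → n ^ n ≤ 8 ^ n * n !
n^n≤8^n*n! zero    = s≤s z≤n
n^n≤8^n*n! (suc n) = begin
  suc n * suc n ^ n          ≤⟨ *-monoʳ-≤ (suc n) ([1+n]^n≤8*n^n n) ⟩
  suc n * (8 * n ^ n)        ≤⟨ *-monoʳ-≤ (suc n) (*-monoʳ-≤ 8 (n^n≤8^n*n! n)) ⟩
  suc n * (8 * (8 ^ n * n !))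
    ≡⟨ solve 3 (λ a b c → a :* (con 8 :* (b :* c)) := con 8 :* b :* (a :* c)) refl (suc n) (8 ^ n) (n !) ⟩
  8 ^ suc n * (suc n * n !)  ∎
  where open ≤-Reasoning

crossing : ∀ (f : ℕ → ℕ) n k → f 0 ≤ n → n < f k → ∃ λ r → f r ≤ n × n < f (suc r)
crossing f n zero    f0≤n n<f0 = ⊥-elim (<-irrefl refl (<-≤-trans n<f0 f0≤n))
crossing f n (suc k) f0≤n n<fk with f k ≤? n
... | yes fk≤n = k , fk≤n , n<fk
... | no  fk≰n = crossing f n k f0≤n (≰⇒> fk≰n)

B*[2r]^[rK]≤[1+2r]^[rK+K]⇒B≤[6r]^K : ∀ r K B → 1 ≤ r →
  B * (2 * r) ^ (r * K) ≤ suc (2 * r) ^ (r * K + K) → B ≤ (6 * r) ^ K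
B*[2r]^[rK]≤[1+2r]^[rK+K]⇒B≤[6r]^K r@(suc r′) K B _ B-bound = *-cancelʳ-≤ B ((6 * r) ^ K) Q (begin
  B * Q                                   ≤⟨ B-bound ⟩
  suc q ^ (r * K + K)                     ≡⟨ ^-distribˡ-+-* (suc q) (r * K) K ⟩
  suc q ^ (r * K) * suc q ^ K             ≤⟨ *-monoˡ-≤ (suc q ^ K) [1+q]^rK≤2^K*Q ⟩
  2 ^ K * Q * suc q ^ K                   ≡⟨ *-CS.xy∙z≈xz∙y (2 ^ K) Q (suc q ^ K) ⟩
  2 ^ K * suc q ^ K * Q                   ≡⟨ cong (_* Q) (^-distribʳ-* 2 (suc q) K) ⟨
  (2 * suc q) ^ K * Q                     ≤⟨ *-monoˡ-≤ Q (^-monoˡ-≤ K 2[1+q]≤6r) ⟩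
  (6 * r) ^ K * Q                         ∎)
  where
  open ≤-Reasoning
  q = 2 * r
  Q = q ^ (r * K)
  instance
    Q≢0 : NonZero Q
    Q≢0 = m^n≢0 q (r * K)
  [1+q]^rK≤2^K*Q : suc q ^ (r * K) ≤ 2 ^ K * Q
  [1+q]^rK≤2^K*Q = begin
    suc q ^ (r * K)   ≡⟨ ^-*-assoc (suc q) r K ⟨
    (suc q ^ r) ^ K   ≤⟨ ^-monoˡ-≤ K ([1+q]^k≤2*q^k q r ≤-refl) ⟩
    (2 * q ^ r) ^ K   ≡⟨ ^-distribʳ-* 2 (q ^ r) K ⟩
    2 ^ K * (q ^ r) ^ K ≡⟨ cong (2 ^ K *_) (^-*-assoc q r K) ⟩
    2 ^ K * Q         ∎
  2[1+q]≤6r : 2 * suc q ≤ 6 * r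
  2[1+q]≤6r = subst₂ _≤_
    (solve 1 (λ x → con 6 :+ con 4 :* x := con 2 :* (con 1 :+ con 2 :* (con 1 :+ x))) refl r′)
    (solve 1 (λ x → con 6 :+ con 4 :* x :+ con 2 :* x := con 6 :* (con 1 :+ x)) refl r′)
    (m≤m+n (6 + 4 * r′) (2 * r′))

2*[6r]^[p*n]≤n! : ∀ n p r → 1 ≤ p → 1 ≤ n → (96 * r) ^ p ≤ n → 2 * (6 * r) ^ (p * n) ≤ n !
2*[6r]^[p*n]≤n! n p r 1≤p 1≤n [96r]^p≤n = *-cancelˡ-≤ (8 ^ n) (begin
  8 ^ n * (2 * (6 * r) ^ K)           ≤⟨ *-monoʳ-≤ (8 ^ n) (*-monoˡ-≤ ((6 * r) ^ K) (m≤m^n 2 n (s≤s z≤n) 1≤n)) ⟩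
  8 ^ n * (2 ^ n * (6 * r) ^ K)       ≡⟨ *-assoc (8 ^ n) (2 ^ n) _ ⟨
  8 ^ n * 2 ^ n * (6 * r) ^ K         ≡⟨ cong (_* (6 * r) ^ K) (^-distribʳ-* 8 2 n) ⟨
  16 ^ n * (6 * r) ^ K                ≤⟨ *-monoˡ-≤ ((6 * r) ^ K) (^-monoʳ-≤ 16 n≤K) ⟩
  16 ^ K * (6 * r) ^ K                ≡⟨ ^-distribʳ-* 16 (6 * r) K ⟨
  (16 * (6 * r)) ^ K                  ≡⟨ cong (_^ K) (*-assoc 16 6 r) ⟨
  (96 * r) ^ (p * n)                  ≡⟨ ^-*-assoc (96 * r) p n ⟨
  ((96 * r) ^ p) ^ n                  ≤⟨ ^-monoˡ-≤ n [96r]^p≤n ⟩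
  n ^ n                               ≤⟨ n^n≤8^n*n! n ⟩
  8 ^ n * n !                         ∎)
  where
  open ≤-Reasoning
  K = p * n
  instance
    8^n≢0 : NonZero (8 ^ n)
    8^n≢0 = m^n≢0 8 n
  n≤K : n ≤ K
  n≤K = subst (_≤ p * n) (*-identityˡ n) (*-monoˡ-≤ n 1≤p)

-- Markov's inequality, counted: every element not selected contributes at least T to the sum.
length*T≤sum+selected*T : {A : Set} (f : A → ℕ) (T : ℕ) (xs : List A) →
  length xs * T ≤ sum (map f xs) + length (select (λ x → f x <ᵇ T) xs) * T
length*T≤sum+selected*T f T []       = z≤n
length*T≤sum+selected*T f T (x ∷ xs) with f x <ᵇ T in fx<ᵇT
... | true  = begin
  T + length xs * T                          ≤⟨ +-monoʳ-≤ T (length*T≤sum+selected*T f T xs) ⟩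
  T + (sum (map f xs) + C * T)               ≡⟨ +-CS.x∙yz≈y∙xz T (sum (map f xs)) (C * T) ⟩
  sum (map f xs) + (T + C * T)               ≤⟨ m≤n+m _ (f x) ⟩
  f x + (sum (map f xs) + (T + C * T))       ≡⟨ +-assoc (f x) _ _ ⟨
  f x + sum (map f xs) + (T + C * T)         ∎
  where
  open ≤-Reasoning
  C = length (select (λ x → f x <ᵇ T) xs)
... | false = begin
  T + length xs * T                          ≤⟨ +-mono-≤ T≤fx (length*T≤sum+selected*T f T xs) ⟩
  f x + (sum (map f xs) + C * T)             ≡⟨ +-assoc (f x) _ _ ⟨
  f x + sum (map f xs) + C * T               ∎
  where
  open ≤-Reasoning
  C = length (select (λ x → f x <ᵇ T) xs)
  T≤fx : T ≤ f x
  T≤fx = <ᵇ≡false⇒≥ (f x) T fx<ᵇT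

N*T≤S+B*T⇒2*B≤N⇒N*T≤2*S : ∀ N T S B → N * T ≤ S + B * T → 2 * B ≤ N → N * T ≤ 2 * S
N*T≤S+B*T⇒2*B≤N⇒N*T≤2*S N T S B markov 2B≤N = +-cancelʳ-≤ (N * T) (N * T) (2 * S) (begin
  N * T + N * T                 ≤⟨ +-mono-≤ markov markov ⟩
  S + B * T + (S + B * T)
    ≡⟨ solve 3 (λ s b t → s :+ b :* t :+ (s :+ b :* t) := (s :+ (s :+ con 0)) :+ (b :+ (b :+ con 0)) :* t) refl S B T ⟩
  2 * S + 2 * B * T             ≤⟨ +-monoʳ-≤ (2 * S) (*-monoˡ-≤ T 2B≤N) ⟩
  2 * S + N * T                 ∎)
  where open ≤-Reasoning

module _ (n p : ℕ) (hs : List ℕ) (length-hs : length hs ≡ p)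
         (hs≥1 : All (λ h → 1 ≤ h) hs) (last≡1 : last hs ≡ just 1) (1≤p : 1 ≤ p) where

  private
    S K : ℕ
    S = totalOverPerms n hs
    K = p * n

  cost≡ : ∀ {σ} → Permutation n σ → shellCost hs σ ≡ K + sum (inversionTable hs σ)
  cost≡ {σ} (len , _) = trans (shellCost≡ hs σ) (cong₂ (λ a b → a * b + sum (inversionTable hs σ)) length-hs len)

  cheap : ℕ → List (List ℕ)
  cheap T = select (λ σ → shellCost hs σ <ᵇ T) (permsOf n)

  cheap-tables : ∀ r → All (λ σ → Permutation n σ × sum (inversionTable hs σ) < r * K) (cheap (suc r * K))
  cheap-tables r = All.map (λ (perm , cost<T) → perm , +-cancelˡ-< K _ _
      (subst (_< suc r * K) (cost≡ perm) (<ᵇ≡true⇒< _ _ cost<T)))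
    (All-select (λ σ → shellCost hs σ <ᵇ suc r * K) (permsOf-permutation n))

  few-cheap : ∀ r → (96 * r) ^ p ≤ n → 2 * length (cheap (suc r * K)) ≤ n !
  few-cheap zero    _          = subst (λ B → 2 * B ≤ n !) (sym (no-cheap (cheap-tables 0))) z≤n
    where
    no-cheap : ∀ {σs} → All (λ σ → Permutation n σ × sum (inversionTable hs σ) < 0) σs → length σs ≡ 0
    no-cheap []              = refl
    no-cheap ((_ , ()) ∷ _)
  few-cheap r@(suc _) [96r]^p≤n = begin
    2 * B             ≤⟨ *-monoʳ-≤ 2 B≤[6r]^K ⟩
    2 * (6 * r) ^ K   ≤⟨ 2*[6r]^[p*n]≤n! n p r 1≤p 1≤n [96r]^p≤n ⟩
    n !               ∎
    where
    open ≤-Reasoning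
    B = length (cheap (suc r * K))
    tables = map (inversionTable hs) (cheap (suc r * K))
    tables-unique : Unique tables
    tables-unique = unique-map-injectiveOn (inversionTable hs)
      (Unique.filter⁺ (λ σ → (shellCost hs σ <ᵇ suc r * K) ≟ true) (permsOf-unique n)) (cheap-tables r)
      (λ ((len-x , same-x) , _) ((len-y , same-y) , _) → inversionTable-determines hs hs≥1 last≡1 _ _
         (trans len-x (sym len-y)) (λ u → trans (same-x u) (sym (same-y u))))
    tables-bounded : All (Bounded K (r * K)) tables
    tables-bounded = All.map⁺ (All.map (λ {σ} ((len , _) , table<) →
      trans (length-inversionTable hs σ) (cong₂ _*_ length-hs len) , <⇒≤ table<) (cheap-tables r))
    B≤[6r]^K : B ≤ (6 * r) ^ K
    B≤[6r]^K = B*[2r]^[rK]≤[1+2r]^[rK+K]⇒B≤[6r]^K r K B (s≤s z≤n)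
      (subst (λ m → m * (2 * r) ^ (r * K) ≤ suc (2 * r) ^ (r * K + K)) (length-map (inversionTable hs) (cheap (suc r * K)))
        (unique-bounded-count (2 * r) K (r * K) tables tables-unique tables-bounded))
    1≤n : 1 ≤ n
    1≤n = ≤-trans (m^n>0 (96 * r) p) [96r]^p≤n

  n!*[1+r]*K≤2*S : ∀ r → (96 * r) ^ p ≤ n → n ! * (suc r * K) ≤ 2 * S
  n!*[1+r]*K≤2*S r [96r]^p≤n = N*T≤S+B*T⇒2*B≤N⇒N*T≤2*S (n !) (suc r * K) S (length (cheap (suc r * K)))
    (subst (λ N → N * (suc r * K) ≤ S + length (cheap (suc r * K)) * (suc r * K)) (length-permsOf n)
      (length*T≤sum+selected*T (shellCost hs) (suc r * K) (permsOf n)))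
    (few-cheap r [96r]^p≤n)

  n<[96[1+n]]^p : n < (96 * suc n) ^ p
  n<[96[1+n]]^p = <-≤-trans (n<1+n n) (≤-trans (m≤n*m (suc n) 96) (m≤m^n (96 * suc n) p (s≤s z≤n) 1≤p))

  lower-bound-at : ∀ r → (96 * r) ^ p ≤ n → n < (96 * suc r) ^ p → n * (1 * p * n * (n !)) ^ p ≤ (192 * S) ^ p
  lower-bound-at r [96r]^p≤n n<[96[1+r]]^p = begin
    n * X ^ p                  ≤⟨ *-monoˡ-≤ (X ^ p) (<⇒≤ n<[96[1+r]]^p) ⟩
    (96 * suc r) ^ p * X ^ p   ≡⟨ ^-distribʳ-* (96 * suc r) X p ⟨
    (96 * suc r * X) ^ p       ≤⟨ ^-monoˡ-≤ p (begin
      96 * suc r * X           ≡⟨ *-assoc 96 (suc r) X ⟩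
      96 * (suc r * X)         ≡⟨ cong (λ m → 96 * (suc r * m)) X≡n!*K ⟩
      96 * (suc r * (n ! * K)) ≡⟨ cong (96 *_) (*-CS.x∙yz≈y∙xz (suc r) (n !) K) ⟩
      96 * (n ! * (suc r * K)) ≤⟨ *-monoʳ-≤ 96 (n!*[1+r]*K≤2*S r [96r]^p≤n) ⟩
      96 * (2 * S)             ≡⟨ *-assoc 96 2 S ⟨
      192 * S                  ∎) ⟩
    (192 * S) ^ p              ∎
    where
    open ≤-Reasoning
    X = 1 * p * n * (n !)
    X≡n!*K : X ≡ n ! * K
    X≡n!*K = trans (cong (λ m → m * n * (n !)) (*-identityˡ p)) (*-comm K (n !))

  lower-bound : n * (1 * p * n * (n !)) ^ p ≤ (192 * S) ^ p
  lower-bound = let r , [96r]^p≤n , n<[96[1+r]]^p = crossing (λ r → (96 * r) ^ p) n (suc n)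
                      (subst (_≤ n) (sym (0^n≡0 p 1≤p)) z≤n) n<[96[1+n]]^p
                in lower-bound-at r [96r]^p≤n n<[96[1+r]]^p

corollary1 : ∃[ a ] ∃[ b ] ∃[ N ] (1 ≤ a × 1 ≤ b ×
    (∀ (n : ℕ) → N ≤ n → ∀ (p : ℕ) (hs : List ℕ) →
      length hs ≡ p → 1 ≤ p → p ≤ ⌊log₂ n ⌋ →
      All (λ h → 1 ≤ h) hs → last hs ≡ just 1 →
      n * (a * p * n * (n !)) ^ p ≤ (b * totalOverPerms n hs) ^ p))
corollary1 = 1 , 192 , 0 , s≤s z≤n , s≤s z≤n ,
  λ n _ p hs length-hs 1≤p _ hs≥1 last≡1 → lower-bound n p hs length-hs hs≥1 last≡1 1≤p
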